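{- Let $C$ be a finite set of $N$ pick-up points, each $c\in C$ having a probability $P(c)\in[0,1]$, and write $\overline{P(c)}=1-P(c)$. Let $D_{x,y}$ denote the distance between locations $x,y$. For a potential sequence $\vec r=\langle c_1,\dots,c_L\rangle$ (distinct elements of $C$, $L\ge 1$) define $$F1(\vec r)=\sum_{j=2}^{L}\Big(\sum_{i=2}^{j}D_{c_{i-1},c_i}\Big)\Big(\prod_{i=2}^{j-1}\overline{P(c_i)}\Big)P(c_j)$$ (so $F1(\vec r)=0$ when $L=1$) and $$PE(\vec r)=\sum_{j=1}^{L}\Big(\prod_{i=1}^{j-1}\overline{P(c_i)}\Big)P(c_j)=1-\prod_{i=1}^{L}\overline{P(c_i)}.$$ Let $\vec r_1=\langle c_1,c_2,\dots,c_k\rangle$ be a potential sequence with $2\le k\le N$ and let $\vec r_2=\langle c_2,\dots,c_k\rangle$ be its postfix sub-sequence. Then $$F1(\vec r_1)=\overline{P(c_2)}\cdot F1(\vec r_2)+D_{c_1,c_2}\cdot PE(\vec r_2).$$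
   Context: A potential sequence is a finite sequence of pairwise distinct pick-up points from $C$. $F1$ is called the PTD sub-function of the sequence and $PE$ its probability summation. Empty products equal $1$. -}

module Defs where

open import Level using (Level)
open import Algebra.Bundles using (CommutativeRing)
open import Data.Nat using (ℕ; zero; suc; _∸_; _≤_)
open import Relation.Binary.PropositionalEquality using (_≡_)

-- Everything is stated over an arbitrary commutative ring R
-- (the paper's setting is the reals, which is an instance).
module Seq {c ℓ : Level} (R : CommutativeRing c ℓ) where
  open CommutativeRing R

  sumFrom : (ℕ → Carrier) → ℕ → ℕ → Carrier
  sumFrom f a zero    = 0#
  sumFrom f a (suc n) = f a + sumFrom f (suc a) n

  prodFrom : (ℕ → Carrier) → ℕ → ℕ → Carrier
  prodFrom f a zero    = 1#
  prodFrom f a (suc n) = f a * prodFrom f (suc a) n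

  -- ∑_{i=a}^{b} f i  (empty, i.e. 0, when b < a)
  sumRange : ℕ → ℕ → (ℕ → Carrier) → Carrier
  sumRange a b f = sumFrom f a (suc b ∸ a)

  -- ∏_{i=a}^{b} f i  (empty, i.e. 1, when b < a)
  prodRange : ℕ → ℕ → (ℕ → Carrier) → Carrier
  prodRange a b f = prodFrom f a (suc b ∸ a)

  bar : Carrier → Carrier
  bar p = 1# - p

  -- A sequence ⟨c_1,…,c_L⟩ of points of C is represented by its length L
  -- together with a map s : ℕ → C, where c_i = s i for 1 ≤ i ≤ L
  -- (values of s outside 1..L are irrelevant).
  module _ {C : Set} (P : C → Carrier) (D : C → C → Carrier) where

    F1 : ℕ → (ℕ → C) → Carrier
    F1 L s = sumRange 2 L (λ j →
               (sumRange 2 j (λ i → D (s (i ∸ 1)) (s i)))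
             * (prodRange 2 (j ∸ 1) (λ i → bar (P (s i))))
             * P (s j))

    PE : ℕ → (ℕ → C) → Carrier
    PE L s = sumRange 1 L (λ j → prodRange 1 (j ∸ 1) (λ i → bar (P (s i))) * P (s j))

PairwiseDistinct : {C : Set} → ℕ → (ℕ → C) → Set
PairwiseDistinct L s = ∀ i j → 1 ≤ i → i ≤ L → 1 ≤ j → j ≤ L → s i ≡ s j → i ≡ j

module Submission where

-- Splitting the first leg D(c₁,c₂) off every cumulative distance in F1(r₁) turns
-- its (j+1)-st summand into bar P(c₂) times the j-th summand of F1(r₂) plus
-- D(c₁,c₂) times the j-th summand of PE(r₂); summing over j gives the recurrence,
-- the first summand of F1(r₂) being an empty distance sum.

open import Defs
open import Level using (Level)
open import Algebra.Bundles using (CommutativeRing)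
open import Data.Nat using (ℕ; zero; suc; _≤_; _∸_; s≤s)
open import Data.Nat.Properties using (≤-refl; m≤n⇒m≤1+n; ≤-pred)
open import Data.Fin using (Fin)
open import Function using (_∘_)
open import Relation.Binary.PropositionalEquality using (_≡_; cong)
import Algebra.Properties.CommutativeSemigroup as CommutativeSemigroupProperties

module Recurrence {c ℓ : Level} (R : CommutativeRing c ℓ) where
  open CommutativeRing R
  open Seq R
  open CommutativeSemigroupProperties +-commutativeSemigroup using (interchange)
  open CommutativeSemigroupProperties *-commutativeSemigroup using (x∙yz≈y∙xz)
  open import Relation.Binary.Reasoning.Setoid setoid

  sumFrom-cong : ∀ {f g : ℕ → Carrier} a n →
                 (∀ i → a ≤ i → f i ≈ g i) → sumFrom f a n ≈ sumFrom g a n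
  sumFrom-cong a zero    f≈g = refl
  sumFrom-cong a (suc n) f≈g =
    +-cong (f≈g a ≤-refl) (sumFrom-cong (suc a) n (λ i a<i → f≈g i (≤-pred (m≤n⇒m≤1+n a<i))))

  sumFrom-suc : ∀ (f : ℕ → Carrier) a n → sumFrom f (suc a) n ≡ sumFrom (f ∘ suc) a n
  sumFrom-suc f a zero    = _≡_.refl
  sumFrom-suc f a (suc n) = cong (f (suc a) +_) (sumFrom-suc f (suc a) n)

  prodFrom-suc : ∀ (f : ℕ → Carrier) a n → prodFrom f (suc a) n ≡ prodFrom (f ∘ suc) a n
  prodFrom-suc f a zero    = _≡_.refl
  prodFrom-suc f a (suc n) = cong (f (suc a) *_) (prodFrom-suc f (suc a) n)

  sumFrom-+ : ∀ (f g : ℕ → Carrier) a n →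
              sumFrom (λ i → f i + g i) a n ≈ sumFrom f a n + sumFrom g a n
  sumFrom-+ f g a zero    = sym (+-identityˡ 0#)
  sumFrom-+ f g a (suc n) = begin
    (f a + g a) + sumFrom (λ i → f i + g i) (suc a) n
      ≈⟨ +-congˡ (sumFrom-+ f g (suc a) n) ⟩
    (f a + g a) + (sumFrom f (suc a) n + sumFrom g (suc a) n)
      ≈⟨ interchange (f a) (g a) _ _ ⟩
    (f a + sumFrom f (suc a) n) + (g a + sumFrom g (suc a) n) ∎

  *-distribˡ-sumFrom : ∀ x (f : ℕ → Carrier) a n →
                       x * sumFrom f a n ≈ sumFrom (λ i → x * f i) a n
  *-distribˡ-sumFrom x f a zero    = zeroʳ x
  *-distribˡ-sumFrom x f a (suc n) = begin
    x * (f a + sumFrom f (suc a) n)        ≈⟨ distribˡ x _ _ ⟩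
    x * f a + x * sumFrom f (suc a) n      ≈⟨ +-congˡ (*-distribˡ-sumFrom x f (suc a) n) ⟩
    x * f a + sumFrom (λ i → x * f i) (suc a) n ∎

  module _ {C : Set} (P : C → Carrier) (D : C → C → Carrier) where

    leg : (ℕ → C) → ℕ → Carrier
    leg s i = D (s (i ∸ 1)) (s i)

    miss : (ℕ → C) → ℕ → Carrier
    miss s i = bar (P (s i))

    F1-term : (ℕ → C) → ℕ → Carrier
    F1-term s j = sumRange 2 j (leg s) * prodRange 2 (j ∸ 1) (miss s) * P (s j)

    PE-term : (ℕ → C) → ℕ → Carrier
    PE-term s j = prodRange 1 (j ∸ 1) (miss s) * P (s j)

    F1-term-1≈0 : ∀ s → F1-term s 1 ≈ 0#
    F1-term-1≈0 s = trans (*-congʳ (zeroˡ _)) (zeroˡ _)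

    legs-cons : ∀ s j → 1 ≤ j →
                sumRange 2 (suc j) (leg s) ≈ D (s 1) (s 2) + sumRange 2 j (leg (s ∘ suc))
    legs-cons s (suc j) _ = +-congˡ (begin
      sumFrom (leg s) 3 j              ≡⟨ sumFrom-suc (leg s) 2 j ⟩
      sumFrom (leg s ∘ suc) 2 j        ≈⟨ sumFrom-cong 2 j (λ { (suc i) _ → refl }) ⟩
      sumFrom (leg (s ∘ suc)) 2 j      ∎)

    -- For j ≤ 1 the leg sum is empty, so both sides vanish whatever the products are.
    legs*misses : ∀ s j →
                  sumRange 2 j (leg (s ∘ suc)) * prodRange 2 j (miss s)
                  ≈ miss s 2 * (sumRange 2 j (leg (s ∘ suc)) * prodRange 2 (j ∸ 1) (miss (s ∘ suc)))
    legs*misses s zero          = trans (zeroˡ _) (sym (trans (*-congˡ (zeroˡ _)) (zeroʳ _)))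
    legs*misses s (suc zero)    = trans (zeroˡ _) (sym (trans (*-congˡ (zeroˡ _)) (zeroʳ _)))
    legs*misses s (suc (suc j)) = begin
      L * (miss s 2 * prodFrom (miss s) 3 j)
        ≡⟨ cong (λ Π → L * (miss s 2 * Π)) (prodFrom-suc (miss s) 2 j) ⟩
      L * (miss s 2 * prodFrom (miss (s ∘ suc)) 2 j)
        ≈⟨ x∙yz≈y∙xz L _ _ ⟩
      miss s 2 * (L * prodFrom (miss (s ∘ suc)) 2 j) ∎
      where L = sumRange 2 (suc (suc j)) (leg (s ∘ suc))

    F1-term-suc : ∀ s j → 1 ≤ j →
                  F1-term s (suc j) ≈ miss s 2 * F1-term (s ∘ suc) j + D (s 1) (s 2) * PE-term (s ∘ suc) j
    F1-term-suc s j 1≤j = begin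
      sumRange 2 (suc j) (leg s) * Π * p          ≈⟨ *-congʳ (*-congʳ (legs-cons s j 1≤j)) ⟩
      (d + L) * Π * p                             ≈⟨ *-congʳ (distribʳ Π d L) ⟩
      (d * Π + L * Π) * p                         ≈⟨ distribʳ p _ _ ⟩
      d * Π * p + L * Π * p                       ≈⟨ +-comm _ _ ⟩
      L * Π * p + d * Π * p                       ≈⟨ +-cong (*-congʳ (legs*misses s j)) (*-assoc d Π p) ⟩
      miss s 2 * (L * Π′) * p + d * (Π * p)       ≈⟨ +-congʳ (*-assoc _ _ p) ⟩
      miss s 2 * (L * Π′ * p) + d * (Π * p)
        ≡⟨ cong (λ Π″ → miss s 2 * (L * Π′ * p) + d * (Π″ * p)) (prodFrom-suc (miss s) 1 (j ∸ 1)) ⟩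
      miss s 2 * F1-term (s ∘ suc) j + d * PE-term (s ∘ suc) j ∎
      where
        d  = D (s 1) (s 2)
        L  = sumRange 2 j (leg (s ∘ suc))
        Π  = prodRange 2 j (miss s)
        Π′ = prodRange 2 (j ∸ 1) (miss (s ∘ suc))
        p  = P (s (suc j))

    F1-cons : ∀ s m →
              F1 P D (suc (suc m)) s
              ≈ bar (P (s 2)) * F1 P D (suc m) (s ∘ suc) + D (s 1) (s 2) * PE P D (suc m) (s ∘ suc)
    F1-cons s m = begin
      sumFrom (F1-term s) 2 (suc m)                     ≡⟨ sumFrom-suc (F1-term s) 1 (suc m) ⟩
      sumFrom (F1-term s ∘ suc) 1 (suc m)               ≈⟨ sumFrom-cong 1 (suc m) (F1-term-suc s) ⟩
      sumFrom (λ j → q * F1′ j + d * PE′ j) 1 (suc m)   ≈⟨ sumFrom-+ _ _ 1 (suc m) ⟩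
      sumFrom (λ j → q * F1′ j) 1 (suc m) + sumFrom (λ j → d * PE′ j) 1 (suc m)
        ≈⟨ sym (+-cong (*-distribˡ-sumFrom q F1′ 1 (suc m)) (*-distribˡ-sumFrom d PE′ 1 (suc m))) ⟩
      q * (F1′ 1 + sumFrom F1′ 2 m) + d * sumFrom PE′ 1 (suc m)
        ≈⟨ +-congʳ (*-congˡ (trans (+-congʳ (F1-term-1≈0 (s ∘ suc))) (+-identityˡ _))) ⟩
      q * sumFrom F1′ 2 m + d * sumFrom PE′ 1 (suc m) ∎
      where
        q   = miss s 2
        d   = D (s 1) (s 2)
        F1′ = F1-term (s ∘ suc)
        PE′ = PE-term (s ∘ suc)

theorem1 : {c ℓ : Level} (R : CommutativeRing c ℓ) (N : ℕ)
           (P : Fin N → CommutativeRing.Carrier R)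
           (D : Fin N → Fin N → CommutativeRing.Carrier R)
           (k : ℕ) (s : ℕ → Fin N) →
           2 ≤ k → k ≤ N → PairwiseDistinct k s →
           CommutativeRing._≈_ R
             (Seq.F1 R P D k s)
             (CommutativeRing._+_ R
               (CommutativeRing._*_ R (Seq.bar R (P (s 2))) (Seq.F1 R P D (k ∸ 1) (λ i → s (suc i))))
               (CommutativeRing._*_ R (D (s 1) (s 2)) (Seq.PE R P D (k ∸ 1) (λ i → s (suc i)))))
theorem1 R N P D (suc (suc m)) s (s≤s (s≤s _)) _ _ = Recurrence.F1-cons R P D s m
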